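{- Let $n$ be a positive even integer. Then there is a Gray code for $\mathcal{P}^{\mathrm{adj}}_{n+1}$, i.e. a listing of all $(n+1)!$ permutations of $[n+1]$ in which consecutive permutations differ by an adjacent transposition, starting at $12\cdots(n+1)$ and ending at $213\cdots(n+1)$.
   Context: Permutations of $[N]$ are written in one-line notation $\pi_1\cdots\pi_N$. $\mathcal{P}^{\mathrm{adj}}_N$ (the permutahedron) is the graph on the permutations of $[N]$ in which two permutations are adjacent iff one is obtained from the other by an adjacent transposition $(i,i+1)$, $i\in[N-1]$, i.e. by swapping the entries in positions $i$ and $i+1$. A Gray code for it is a Hamiltonian path. -}

module Defs where

open import Data.Nat using (ℕ; zero; suc; _<_; _≟_)
open import Data.Fin using (Fin; toℕ; fromℕ<) renaming (zero to fz; suc to fs)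
open import Data.Fin.Properties using (toℕ<n)
open import Data.Nat.Properties using (<-trans; n<1+n)
open import Data.Vec using (Vec; lookup; tabulate; allFin)
open import Data.List using (List; head; last)
open import Data.List.Membership.Propositional using (_∈_)
open import Data.List.Relation.Unary.Unique.Propositional using (Unique)
open import Data.List.Relation.Unary.Linked using (Linked)
open import Data.Maybe using (just)
open import Data.Product using (Σ; ∃; _×_; _,_)
open import Function.Definitions using (Injective)
open import Relation.Nullary using (yes; no)
open import Relation.Binary.PropositionalEquality using (_≡_)

-- A permutation of [N] in one-line notation π₁ ⋯ π_N, 0-indexed:
-- the entry at position j : Fin N is the value π_{j+1} - 1 : Fin N.
-- A word of length N over Fin N is a permutation iff it is injective.
IsPerm : {N : ℕ} → Vec (Fin N) N → Set
IsPerm w = Injective _≡_ _≡_ (lookup w)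

τ : {N : ℕ} (i : ℕ) → suc i < N → Fin N → Fin N
τ i si<N j with toℕ j ≟ i | toℕ j ≟ suc i
... | yes _ | _     = fromℕ< si<N
... | no _  | yes _ = fromℕ< (<-trans (n<1+n i) si<N)
... | no _  | no _  = j

AdjSwap : {N : ℕ} → Vec (Fin N) N → Vec (Fin N) N → Set
AdjSwap {N} p q =
  ∃ λ i → Σ (suc i < N) λ si<N → ∀ j → lookup q j ≡ lookup p (τ i si<N j)

idPerm : (N : ℕ) → Vec (Fin N) N
idPerm N = allFin N

perm213 : (N : ℕ) → 1 < N → Vec (Fin N) N
perm213 N 1<N = tabulate (τ 0 1<N)

IsGrayCode : (N : ℕ) → List (Vec (Fin N) N) → Set
IsGrayCode N L =
  (∀ {w} → w ∈ L → IsPerm w) ×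
  (∀ w → IsPerm w → w ∈ L) ×
  Unique L ×
  Linked AdjSwap L

{-# OPTIONS --safe #-}
-- Steinhaus–Johnson–Trotter. From a Gray code p₁, …, p_M for the permutations of [N], one for
-- [N+1] arises by sweeping the new largest entry N+1 through each pᵢ, alternately from right to
-- left and from left to right. Inside a sweep N+1 moves one step at a time, and two consecutive
-- sweeps meet at words with N+1 at the same end, which differ exactly as pᵢ and pᵢ₊₁ do.
-- Starting with a leftward sweep over p₁ = 12⋯N keeps the identity first. For N ≥ 2 the number
-- M = N! of sweeps is even, so the last sweep is rightward and ends with N+1 appended to p_M,
-- which is 213⋯N by induction.
module Submission where

open import Defs
open import Data.Bool using (Bool; true; false; not)
open import Data.Fin using (Fin; toℕ; fromℕ; fromℕ<; inject₁; lower₁; punchIn; punchOut)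
  renaming (zero to fz; suc to fs)
import Data.Fin.Properties as Fin
open import Data.Fin.Properties
  using (toℕ-injective; toℕ-fromℕ; fromℕ≢inject₁; inject₁-injective; inject₁-lower₁;
         lower₁-injective; any?; injective⇒≤; punchInᵢ≢i; punchIn-injective; punchIn-punchOut;
         punchOut-injective; punchOut-punchIn)
open import Data.List using (List; []; _∷_; _++_; [_]; head; last; length; reverse)
  renaming (map to mapᴸ; _∷ʳ_ to _∷ʳᴸ_)
open import Data.List.Properties
  using (length-map; length-++; length-reverse; head-map; last-map; ++-identityʳ;
         unfold-reverse; reverse-involutive)
open import Data.List.Membership.Propositional using (_∈_)
open import Data.List.Membership.Propositional.Properties
  using (∈-map⁺; ∈-map⁻; ∈-++⁺ˡ; ∈-++⁺ʳ; ∈-++⁻)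
open import Data.List.Relation.Unary.Any using (here; there)
import Data.List.Relation.Unary.Any.Properties as Any
open import Data.List.Relation.Unary.All using ([]; _∷_)
import Data.List.Relation.Unary.All as All
import Data.List.Relation.Unary.All.Properties as All
open import Data.List.Relation.Unary.AllPairs using ([]; _∷_)
open import Data.List.Relation.Unary.Unique.Propositional using (Unique)
import Data.List.Relation.Unary.Unique.Propositional.Properties as Unique
open import Data.List.Relation.Unary.Linked using (Linked; []; [-]; _∷_)
import Data.List.Relation.Unary.Linked as Linked
import Data.List.Relation.Unary.Linked.Properties as Linked
open import Data.Maybe using (just) renaming (map to mapᴹ)
open import Data.Maybe.Relation.Binary.Connected using (Connected; just)
open import Data.Nat using (ℕ; zero; suc; _+_; _*_; _<_; _≟_; _!; s≤s; z≤n)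
open import Data.Nat.Properties using (suc-injective; <-irrefl; <-trans; n<1+n; 1+n≰n; *-suc; *-zeroʳ)
open import Data.Nat.Divisibility using (_∣_; ∣-refl; ∣1⇒≡1; ∣m+n∣m⇒∣n; m≤n⇒m!∣n!)
open import Data.Product using (∃; ∃₂; Σ; _×_; _,_; proj₁; proj₂)
open import Data.Sum using (_⊎_; inj₁; inj₂)
open import Data.Vec using (Vec; []; _∷_; _∷ʳ_; lookup; tabulate; allFin; insertAt; removeAt; map)
open import Data.Vec.Properties
  using (∷-injectiveˡ; ∷-injectiveʳ; insertAt-lookup; insertAt-punchIn; insertAt-removeAt;
         removeAt-punchOut; lookup-map; lookup∘tabulate; tabulate∘lookup; tabulate-∘; tabulate-cong)
open import Data.Vec.Relation.Unary.All using ([]; _∷_) renaming (All to Allⱽ)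
import Data.Vec.Relation.Unary.All as Allⱽ
import Data.Vec.Relation.Unary.All.Properties as Allⱽ
open import Function using (_∘_; id)
open import Function.Definitions using (Injective)
open import Relation.Binary.Definitions using (Symmetric)
open import Relation.Nullary using (¬_; yes; no; contradiction)
open import Relation.Binary.PropositionalEquality
  using (_≡_; _≢_; refl; sym; trans; cong; cong₂; subst; subst₂; module ≡-Reasoning)

private
  variable
    A : Set
    m n : ℕ
    v x : A
    xs ys : Vec A n

last-∷ʳ : ∀ (xs : List A) x → last (xs ∷ʳᴸ x) ≡ just x
last-∷ʳ []           x = refl
last-∷ʳ (_ ∷ [])     x = refl
last-∷ʳ (_ ∷ y ∷ xs) x = last-∷ʳ (y ∷ xs) x

last-reverse : ∀ (xs : List A) → last (reverse xs) ≡ head xs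
last-reverse []       = refl
last-reverse (x ∷ xs) = trans (cong last (unfold-reverse x xs)) (last-∷ʳ (reverse xs) x)

head-reverse : ∀ (xs : List A) → head (reverse xs) ≡ last xs
head-reverse xs = trans (sym (last-reverse (reverse xs))) (cong last (reverse-involutive xs))

head-++ : ∀ {xs : List A} ys → head xs ≡ just x → head (xs ++ ys) ≡ just x
head-++ {xs = _ ∷ _} ys h = h

last-++ : ∀ (xs : List A) {ys} → last ys ≡ just x → last (xs ++ ys) ≡ just x
last-++ []                   h = h
last-++ (_ ∷ [])     {_ ∷ _} h = h
last-++ (_ ∷ y ∷ xs)         h = last-++ (y ∷ xs) h

Linked-reverse : ∀ {R : A → A → Set} → Symmetric R → ∀ {xs} → Linked R xs → Linked R (reverse xs)
Linked-reverse R-sym []  = []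
Linked-reverse R-sym [-] = [-]
Linked-reverse {R = R} R-sym {x ∷ y ∷ xs} (x∼y ∷ l) =
  subst (Linked R) (sym (unfold-reverse x (y ∷ xs))) (Linked.++⁺ (Linked-reverse R-sym l) y∼x [-])
  where
  y∼x : Connected R (last (reverse (y ∷ xs))) (just x)
  y∼x = subst (λ z → Connected R z (just x)) (sym (last-reverse (y ∷ xs))) (just (R-sym x∼y))

Unique-reverse : ∀ {xs : List A} → Unique xs → Unique (reverse xs)
Unique-reverse []                     = []
Unique-reverse {xs = x ∷ xs} (x∉ ∷ u) =
  subst Unique (sym (unfold-reverse x xs)) (Unique.++⁺ (Unique-reverse u) ([] ∷ []) x∉reverse)
  where
  x∉reverse : ∀ {w} → ¬ (w ∈ reverse xs × w ∈ [ x ])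
  x∉reverse (w∈ , here refl) = All.lookup x∉ (Any.reverse⁻ w∈) refl

data Swap {A : Set} : Vec A n → Vec A n → Set where
  swap : ∀ {x y} {xs : Vec A n} → Swap (x ∷ y ∷ xs) (y ∷ x ∷ xs)
  prep : ∀ {x} {xs ys : Vec A n} → Swap xs ys → Swap (x ∷ xs) (x ∷ ys)

Swap-sym : Symmetric (Swap {A} {n})
Swap-sym swap     = swap
Swap-sym (prep s) = prep (Swap-sym s)

Swap-map : ∀ {B : Set} (f : A → B) → Swap xs ys → Swap (map f xs) (map f ys)
Swap-map f swap     = swap
Swap-map f (prep s) = prep (Swap-map f s)

Swap-∷ʳ : Swap xs ys → Swap (xs ∷ʳ v) (ys ∷ʳ v)
Swap-∷ʳ swap     = swap
Swap-∷ʳ (prep s) = prep (Swap-∷ʳ s)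

-- τ i si j only computes once toℕ j ≟ i and toℕ j ≟ suc i are decided, so for a variable j
-- it is handled through the following three equations.
τ-at-i : ∀ i (si : suc i < n) j → toℕ j ≡ i → τ i si j ≡ fromℕ< si
τ-at-i i si j j≡i with toℕ j ≟ i
... | yes _  = refl
... | no j≢i = contradiction j≡i j≢i

τ-at-suc-i : ∀ i (si : suc i < n) j → toℕ j ≡ suc i → τ i si j ≡ fromℕ< (<-trans (n<1+n i) si)
τ-at-suc-i i si j j≡1+i with toℕ j ≟ i | toℕ j ≟ suc i
... | yes j≡i | _        = contradiction (n<1+n i) (<-irrefl (trans (sym j≡i) j≡1+i))
... | no _    | yes _    = refl
... | no _    | no j≢1+i = contradiction j≡1+i j≢1+i

τ-elsewhere : ∀ i (si : suc i < n) j → toℕ j ≢ i → toℕ j ≢ suc i → τ i si j ≡ j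
τ-elsewhere i si j j≢i j≢1+i with toℕ j ≟ i | toℕ j ≟ suc i
... | yes j≡i | _         = contradiction j≡i j≢i
... | no _    | yes j≡1+i = contradiction j≡1+i j≢1+i
... | no _    | no _      = refl

τ-suc : ∀ i (si : suc i < n) j → τ (suc i) (s≤s si) (fs j) ≡ fs (τ i si j)
τ-suc i si j with toℕ j ≟ i | toℕ j ≟ suc i
... | yes j≡i | _         = τ-at-i (suc i) (s≤s si) (fs j) (cong suc j≡i)
... | no _    | yes j≡1+i = τ-at-suc-i (suc i) (s≤s si) (fs j) (cong suc j≡1+i)
... | no j≢i  | no j≢1+i  =
  τ-elsewhere (suc i) (s≤s si) (fs j) (j≢i ∘ suc-injective) (j≢1+i ∘ suc-injective)

Swap⇒lookup-τ : Swap xs ys → ∃ λ i → Σ (suc i < n) λ si → ∀ j → lookup ys j ≡ lookup xs (τ i si j)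
Swap⇒lookup-τ swap = 0 , s≤s (s≤s z≤n) , λ { fz → refl ; (fs fz) → refl ; (fs (fs j)) → refl }
Swap⇒lookup-τ {xs = x ∷ xs} (prep s) with Swap⇒lookup-τ s
... | i , si , ys≡xs∘τ = suc i , s≤s si , λ
  { fz     → refl
  ; (fs j) → trans (ys≡xs∘τ j) (cong (lookup (x ∷ xs)) (sym (τ-suc i si j)))
  }

map-injective : ∀ {B : Set} {f : A → B} → Injective _≡_ _≡_ f → Injective _≡_ _≡_ (map {n = n} f)
map-injective f-inj {[]}    {[]}    _  = refl
map-injective f-inj {_ ∷ _} {_ ∷ _} eq =
  cong₂ _∷_ (f-inj (∷-injectiveˡ eq)) (map-injective f-inj (∷-injectiveʳ eq))

insertAt-injectiveˡ : ∀ {xs ys : Vec A n} i j → Allⱽ (v ≢_) xs → Allⱽ (v ≢_) ys →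
                      insertAt xs i v ≡ insertAt ys j v → xs ≡ ys
insertAt-injectiveˡ fz     fz     _              _              eq = ∷-injectiveʳ eq
insertAt-injectiveˡ fz     (fs j) _              (v≢y ∷ _)      eq = contradiction (∷-injectiveˡ eq) v≢y
insertAt-injectiveˡ (fs i) fz     (v≢x ∷ _)      _              eq =
  contradiction (sym (∷-injectiveˡ eq)) v≢x
insertAt-injectiveˡ (fs i) (fs j) (_ ∷ fresh-xs) (_ ∷ fresh-ys) eq =
  cong₂ _∷_ (∷-injectiveˡ eq) (insertAt-injectiveˡ i j fresh-xs fresh-ys (∷-injectiveʳ eq))

punchIn-view : ∀ (i j : Fin (suc n)) → j ≡ i ⊎ ∃ λ k → j ≡ punchIn i k
punchIn-view i j with i Fin.≟ j
... | yes i≡j = inj₁ (sym i≡j)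
... | no i≢j  = inj₂ (punchOut i≢j , sym (punchIn-punchOut i≢j))

insertAt-lookup≢punchIn : ∀ (xs : Vec A n) i k → Allⱽ (v ≢_) xs →
  lookup (insertAt xs i v) i ≢ lookup (insertAt xs i v) (punchIn i k)
insertAt-lookup≢punchIn {v = v} xs i k fresh eq =
  Allⱽ.lookup⁺ fresh k (trans (sym (insertAt-lookup xs i v)) (trans eq (insertAt-punchIn xs i v k)))

lookup-insertAt-injective : ∀ (xs : Vec A n) i → Allⱽ (v ≢_) xs →
  Injective _≡_ _≡_ (lookup xs) → Injective _≡_ _≡_ (lookup (insertAt xs i v))
lookup-insertAt-injective {v = v} xs i fresh xs-inj {j} {k} eq with punchIn-view i j | punchIn-view i k
... | inj₁ refl        | inj₁ refl        = refl
... | inj₁ refl        | inj₂ (k′ , refl) = contradiction eq (insertAt-lookup≢punchIn xs i k′ fresh)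
... | inj₂ (j′ , refl) | inj₁ refl        = contradiction (sym eq) (insertAt-lookup≢punchIn xs i j′ fresh)
... | inj₂ (j′ , refl) | inj₂ (k′ , refl) = cong (punchIn i)
  (xs-inj (trans (sym (insertAt-punchIn xs i v j′)) (trans eq (insertAt-punchIn xs i v k′))))

removeAt-punchIn : ∀ (xs : Vec A (suc n)) i k → lookup (removeAt xs i) k ≡ lookup xs (punchIn i k)
removeAt-punchIn xs i k =
  trans (cong (lookup (removeAt xs i)) (sym (punchOut-punchIn i)))
        (removeAt-punchOut xs (punchInᵢ≢i i k ∘ sym))

tabulate-∷ʳ : ∀ (g : Fin n → A) (g′ : Fin (suc n) → A) → (∀ k → g′ (inject₁ k) ≡ g k) →
              tabulate g ∷ʳ g′ (fromℕ n) ≡ tabulate g′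
tabulate-∷ʳ {zero}  g g′ _     = refl
tabulate-∷ʳ {suc n} g g′ g′≗g =
  cong₂ _∷_ (sym (g′≗g fz)) (tabulate-∷ʳ (g ∘ fs) (g′ ∘ fs) (g′≗g ∘ fs))

insertions : A → Vec A n → List (Vec A (suc n))
insertions v []       = [ v ∷ [] ]
insertions v (x ∷ xs) = (v ∷ x ∷ xs) ∷ mapᴸ (x ∷_) (insertions v xs)

length-insertions : ∀ (xs : Vec A n) → length (insertions v xs) ≡ suc n
length-insertions          []       = refl
length-insertions {v = v} (x ∷ xs) =
  cong suc (trans (length-map (x ∷_) (insertions v xs)) (length-insertions xs))

head-insertions : ∀ (xs : Vec A n) → head (insertions v xs) ≡ just (v ∷ xs)
head-insertions []      = refl
head-insertions (_ ∷ _) = refl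

last-insertions : ∀ (xs : Vec A n) → last (insertions v xs) ≡ just (xs ∷ʳ v)
last-insertions          []       = refl
last-insertions {v = v} (x ∷ xs) = last-++ [ v ∷ x ∷ xs ] {mapᴸ (x ∷_) (insertions v xs)}
  (trans (last-map (x ∷_) (insertions v xs)) (cong (mapᴹ (x ∷_)) (last-insertions xs)))

insertions-linked : ∀ (xs : Vec A n) → Linked Swap (insertions v xs)
insertions-linked []           = [-]
insertions-linked (x ∷ [])     = swap ∷ [-]
insertions-linked (x ∷ y ∷ xs) = swap ∷ Linked.map⁺ (Linked.map prep (insertions-linked (y ∷ xs)))

insertions-unique : Allⱽ (v ≢_) xs → Unique (insertions v xs)
insertions-unique []                                  = [] ∷ []
insertions-unique {v = v} {xs = x ∷ xs} (v≢x ∷ fresh) =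
  All.map⁺ (All.universal (λ _ eq → v≢x (∷-injectiveˡ eq)) (insertions v xs))
  ∷ Unique.map⁺ ∷-injectiveʳ (insertions-unique fresh)

∈-insertions⁺ : ∀ (xs : Vec A n) j → insertAt xs j v ∈ insertions v xs
∈-insertions⁺ []       fz     = here refl
∈-insertions⁺ (x ∷ xs) fz     = here refl
∈-insertions⁺ (x ∷ xs) (fs j) = there (∈-map⁺ (x ∷_) (∈-insertions⁺ xs j))

∈-insertions⁻ : ∀ (xs : Vec A n) {w} → w ∈ insertions v xs → ∃ λ j → w ≡ insertAt xs j v
∈-insertions⁻ []       (here w≡)  = fz , w≡
∈-insertions⁻ (x ∷ xs) (here w≡)  = fz , w≡
∈-insertions⁻ (x ∷ xs) (there w∈) with ∈-map⁻ (x ∷_) w∈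
... | w′ , w′∈ , refl with ∈-insertions⁻ xs w′∈
...   | j , refl = fs j , refl

sweep : Bool → A → Vec A n → List (Vec A (suc n))
sweep true  v xs = insertions v xs
sweep false v xs = reverse (insertions v xs)

sweepStart : Bool → A → Vec A n → Vec A (suc n)
sweepStart true  v xs = v ∷ xs
sweepStart false v xs = xs ∷ʳ v

sweepStart-Swap : ∀ d → Swap xs ys → Swap (sweepStart d v xs) (sweepStart d v ys)
sweepStart-Swap true  = prep
sweepStart-Swap false = Swap-∷ʳ

head-sweep : ∀ d (xs : Vec A n) → head (sweep d v xs) ≡ just (sweepStart d v xs)
head-sweep true  xs = head-insertions xs
head-sweep false xs = trans (head-reverse (insertions _ xs)) (last-insertions xs)

last-sweep : ∀ d (xs : Vec A n) → last (sweep d v xs) ≡ just (sweepStart (not d) v xs)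
last-sweep true  xs = last-insertions xs
last-sweep false xs = trans (last-reverse (insertions _ xs)) (head-insertions xs)

length-sweep : ∀ d (xs : Vec A n) → length (sweep d v xs) ≡ suc n
length-sweep true  xs = length-insertions xs
length-sweep false xs = trans (length-reverse (insertions _ xs)) (length-insertions xs)

sweep-linked : ∀ d (xs : Vec A n) → Linked Swap (sweep d v xs)
sweep-linked true  xs = insertions-linked xs
sweep-linked false xs = Linked-reverse Swap-sym (insertions-linked xs)

sweep-unique : ∀ d → Allⱽ (v ≢_) xs → Unique (sweep d v xs)
sweep-unique true  fresh = insertions-unique fresh
sweep-unique false fresh = Unique-reverse (insertions-unique fresh)

∈-sweep⁺ : ∀ d (xs : Vec A n) j → insertAt xs j v ∈ sweep d v xs
∈-sweep⁺ true  xs j = ∈-insertions⁺ xs j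
∈-sweep⁺ false xs j = Any.reverse⁺ (∈-insertions⁺ xs j)

∈-sweep⁻ : ∀ d (xs : Vec A n) {w} → w ∈ sweep d v xs → ∃ λ j → w ≡ insertAt xs j v
∈-sweep⁻ true  xs w∈ = ∈-insertions⁻ xs w∈
∈-sweep⁻ false xs w∈ = ∈-insertions⁻ xs (Any.reverse⁻ w∈)

sjt : Bool → A → List (Vec A n) → List (Vec A (suc n))
sjt d v []         = []
sjt d v (xs ∷ xss) = sweep d v xs ++ sjt (not d) v xss

head-sjt : ∀ d {xss : List (Vec A n)} → head xss ≡ just xs → head (sjt d v xss) ≡ just (sweepStart d v xs)
head-sjt d {xs ∷ xss} refl = head-++ (sjt (not d) _ xss) (head-sweep d xs)

last-sjt : ∀ (xss : List (Vec A n)) → 2 ∣ length xss → last xss ≡ just xs →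
           last (sjt false v xss) ≡ just (xs ∷ʳ v)
last-sjt []       _   ()
last-sjt (_ ∷ []) 2∣1 _ = contradiction (∣1⇒≡1 2∣1) λ ()
last-sjt {v = v} (a ∷ b ∷ []) _ refl =
  last-++ (sweep false v a) (trans (cong last (++-identityʳ (sweep true v b))) (last-sweep true b))
last-sjt {v = v} (a ∷ b ∷ c ∷ xss) 2∣2+l last≡ =
  last-++ (sweep false v a) (last-++ (sweep true v b)
    (last-sjt (c ∷ xss) (∣m+n∣m⇒∣n 2∣2+l (∣-refl {2})) last≡))

length-sjt : ∀ d (xss : List (Vec A n)) → length (sjt d v xss) ≡ suc n * length xss
length-sjt {n = n} d [] = sym (*-zeroʳ (suc n))
length-sjt {n = n} {v = v} d (xs ∷ xss) = begin
  length (sweep d v xs ++ sjt (not d) v xss)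
    ≡⟨ length-++ (sweep d v xs) ⟩
  length (sweep d v xs) + length (sjt (not d) v xss)
    ≡⟨ cong₂ _+_ (length-sweep d xs) (length-sjt (not d) xss) ⟩
  suc n + suc n * length xss
    ≡⟨ *-suc (suc n) (length xss) ⟨
  suc n * suc (length xss)
    ∎
  where open ≡-Reasoning

sjt-linked : ∀ d {xss : List (Vec A n)} → Linked Swap xss → Linked Swap (sjt d v xss)
sjt-linked d []  = []
sjt-linked {v = v} d {xs ∷ []} [-] =
  subst (Linked Swap) (sym (++-identityʳ (sweep d v xs))) (sweep-linked d xs)
sjt-linked {v = v} d {xs ∷ ys ∷ xss} (xs∼ys ∷ l) =
  Linked.++⁺ (sweep-linked d xs) joint (sjt-linked (not d) l)
  where
  joint : Connected Swap (last (sweep d v xs)) (head (sjt (not d) v (ys ∷ xss)))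
  joint = subst₂ (Connected Swap) (sym (last-sweep d xs)) (sym (head-sjt (not d) {ys ∷ xss} refl))
            (just (sweepStart-Swap (not d) xs∼ys))

∈-sjt⁺ : ∀ d {xss : List (Vec A n)} → xs ∈ xss → ∀ j → insertAt xs j v ∈ sjt d v xss
∈-sjt⁺ d            (here refl) j = ∈-++⁺ˡ (∈-sweep⁺ d _ j)
∈-sjt⁺ d {xs′ ∷ _} (there xs∈) j = ∈-++⁺ʳ (sweep d _ xs′) (∈-sjt⁺ (not d) xs∈ j)

∈-sjt⁻ : ∀ d (xss : List (Vec A n)) {w} → w ∈ sjt d v xss →
         ∃ λ xs → xs ∈ xss × ∃ λ j → w ≡ insertAt xs j v
∈-sjt⁻ d (xs ∷ xss) w∈ with ∈-++⁻ (sweep d _ xs) w∈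
... | inj₁ w∈sweep = xs , here refl , ∈-sweep⁻ d xs w∈sweep
... | inj₂ w∈rest with ∈-sjt⁻ (not d) xss w∈rest
...   | ys , ys∈ , hit = ys , there ys∈ , hit

sjt-unique : ∀ d {xss : List (Vec A n)} → (∀ {xs} → xs ∈ xss → Allⱽ (v ≢_) xs) →
             Unique xss → Unique (sjt d v xss)
sjt-unique d fresh [] = []
sjt-unique {v = v} d {xs ∷ xss} fresh (xs∉ ∷ u) =
  Unique.++⁺ (sweep-unique d (fresh (here refl))) (sjt-unique (not d) (fresh ∘ there) u) disjoint
  where
  disjoint : ∀ {w} → ¬ (w ∈ sweep d v xs × w ∈ sjt (not d) v xss)
  disjoint (w∈sweep , w∈rest) with ∈-sweep⁻ d xs w∈sweep | ∈-sjt⁻ (not d) xss w∈rest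
  ... | i , refl | ys , ys∈ , j , eq =
    All.lookup xs∉ ys∈ (insertAt-injectiveˡ i j (fresh (here refl)) (fresh (there ys∈)) eq)

insertTop : Vec (Fin n) m → Fin (suc m) → Vec (Fin (suc n)) (suc m)
insertTop {n} p j = insertAt (map inject₁ p) j (fromℕ n)

fromℕ≢map-inject₁ : ∀ (p : Vec (Fin n) m) → Allⱽ (fromℕ n ≢_) (map inject₁ p)
fromℕ≢map-inject₁ p = Allⱽ.map⁺ (Allⱽ.universal (λ _ → fromℕ≢inject₁) p)

insertTop-IsPerm : ∀ (p : Vec (Fin n) n) j → IsPerm p → IsPerm (insertTop p j)
insertTop-IsPerm p j p-perm = lookup-insertAt-injective (map inject₁ p) j (fromℕ≢map-inject₁ p) lifted-inj
  where
  lifted-inj : Injective _≡_ _≡_ (lookup (map inject₁ p))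
  lifted-inj {a} {b} eq =
    p-perm (inject₁-injective (trans (sym (lookup-map a inject₁ p)) (trans eq (lookup-map b inject₁ p))))

injective⇒surjective : ∀ {f : Fin n → Fin n} → Injective _≡_ _≡_ f → ∀ y → ∃ λ x → f x ≡ y
injective⇒surjective {suc n} {f} f-inj y with any? (λ x → f x Fin.≟ y)
... | yes hit = hit
... | no miss = contradiction (injective⇒≤ g-inj) 1+n≰n
  where
  y≢f : ∀ x → y ≢ f x
  y≢f x y≡fx = miss (x , sym y≡fx)
  g : Fin (suc n) → Fin n
  g x = punchOut (y≢f x)
  g-inj : Injective _≡_ _≡_ g
  g-inj {a} {b} eq = f-inj (punchOut-injective (y≢f a) (y≢f b) eq)

IsPerm⇒insertTop : ∀ (w : Vec (Fin (suc n)) (suc n)) → IsPerm w →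
                   ∃₂ λ p j → IsPerm p × w ≡ insertTop p j
IsPerm⇒insertTop {n} w w-perm = p , j , p-perm , w≡insertTop
  where
  open ≡-Reasoning
  top-hit : ∃ λ j → lookup w j ≡ fromℕ n
  top-hit = injective⇒surjective w-perm (fromℕ n)
  j = proj₁ top-hit
  rest = removeAt w j
  rest-inj : Injective _≡_ _≡_ (lookup rest)
  rest-inj {a} {b} eq = punchIn-injective j a b
    (w-perm (trans (sym (removeAt-punchIn w j a)) (trans eq (removeAt-punchIn w j b))))
  rest≢top : ∀ k → n ≢ toℕ (lookup rest k)
  rest≢top k n≡ = punchInᵢ≢i j k (w-perm (begin
    lookup w (punchIn j k) ≡⟨ removeAt-punchIn w j k ⟨
    lookup rest k          ≡⟨ toℕ-injective (trans (sym n≡) (sym (toℕ-fromℕ n))) ⟩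
    fromℕ n                ≡⟨ proj₂ top-hit ⟨
    lookup w j             ∎))
  p = tabulate (λ k → lower₁ (lookup rest k) (rest≢top k))
  p-perm : IsPerm p
  p-perm {a} {b} eq = rest-inj (lower₁-injective
    (trans (sym (lookup∘tabulate _ a)) (trans eq (lookup∘tabulate _ b))))
  lifted-p : map inject₁ p ≡ rest
  lifted-p = begin
    map inject₁ p                                       ≡⟨ tabulate-∘ inject₁ _ ⟨
    tabulate (λ k → inject₁ (lower₁ (lookup rest k) _)) ≡⟨ tabulate-cong (λ k → inject₁-lower₁ _ (rest≢top k)) ⟩
    tabulate (lookup rest)                              ≡⟨ tabulate∘lookup rest ⟩
    rest                                                ∎
  w≡insertTop : w ≡ insertTop p j
  w≡insertTop = begin
    w                            ≡⟨ insertAt-removeAt w j ⟨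
    insertAt rest j (lookup w j) ≡⟨ cong₂ (λ r t → insertAt r j t) (sym lifted-p) (proj₂ top-hit) ⟩
    insertTop p j                ∎

allFin-∷ʳ : ∀ n → map inject₁ (allFin n) ∷ʳ fromℕ n ≡ allFin (suc n)
allFin-∷ʳ n =
  trans (cong (_∷ʳ fromℕ n) (sym (tabulate-∘ inject₁ id))) (tabulate-∷ʳ inject₁ id λ _ → refl)

perm213-∷ʳ : ∀ K → map inject₁ (perm213 (2 + K) (s≤s (s≤s z≤n))) ∷ʳ fromℕ (2 + K) ≡
                   perm213 (3 + K) (s≤s (s≤s z≤n))
perm213-∷ʳ K =
  trans (cong (_∷ʳ fromℕ (2 + K)) (sym (tabulate-∘ inject₁ τ₀)))
        (tabulate-∷ʳ (inject₁ ∘ τ₀) τ₀′ τ₀′-inject₁)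
  where
  τ₀  = τ {2 + K} 0 (s≤s (s≤s z≤n))
  τ₀′ = τ {3 + K} 0 (s≤s (s≤s z≤n))
  τ₀′-inject₁ : ∀ k → τ₀′ (inject₁ k) ≡ inject₁ (τ₀ k)
  τ₀′-inject₁ fz          = refl
  τ₀′-inject₁ (fs fz)     = refl
  τ₀′-inject₁ (fs (fs k)) = refl

gray : (N : ℕ) → List (Vec (Fin N) N)
gray zero    = [ [] ]
gray (suc N) = sjt false (fromℕ N) (mapᴸ (map inject₁) (gray N))

gray-perm : ∀ N {w} → w ∈ gray N → IsPerm w
gray-perm zero    (here refl) {()}
gray-perm (suc N) w∈ with ∈-sjt⁻ false (mapᴸ (map inject₁) (gray N)) w∈
... | xs , xs∈ , j , refl with ∈-map⁻ (map inject₁) xs∈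
...   | p , p∈ , refl = insertTop-IsPerm p j (gray-perm N p∈)

gray-complete : ∀ N w → IsPerm w → w ∈ gray N
gray-complete zero    [] _      = here refl
gray-complete (suc N) w  w-perm with IsPerm⇒insertTop w w-perm
... | p , j , p-perm , refl = ∈-sjt⁺ false (∈-map⁺ (map inject₁) (gray-complete N p p-perm)) j

gray-unique : ∀ N → Unique (gray N)
gray-unique zero    = [] ∷ []
gray-unique (suc N) =
  sjt-unique false fresh (Unique.map⁺ (map-injective inject₁-injective) (gray-unique N))
  where
  fresh : ∀ {xs} → xs ∈ mapᴸ (map inject₁) (gray N) → Allⱽ (fromℕ N ≢_) xs
  fresh xs∈ with ∈-map⁻ (map inject₁) xs∈
  ... | p , _ , refl = fromℕ≢map-inject₁ p

gray-linked : ∀ N → Linked Swap (gray N)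
gray-linked zero    = [-]
gray-linked (suc N) = sjt-linked false (Linked.map⁺ (Linked.map (Swap-map inject₁) (gray-linked N)))

length-gray : ∀ N → length (gray N) ≡ N !
length-gray zero    = refl
length-gray (suc N) = trans (length-sjt false (mapᴸ (map inject₁) (gray N)))
  (cong (suc N *_) (trans (length-map _ (gray N)) (length-gray N)))

head-gray : ∀ N → head (gray N) ≡ just (idPerm N)
head-gray zero    = refl
head-gray (suc N) =
  trans (head-sjt false (trans (head-map (gray N)) (cong (mapᴹ (map inject₁)) (head-gray N))))
        (cong just (allFin-∷ʳ N))

last-gray : ∀ K → last (gray (2 + K)) ≡ just (perm213 (2 + K) (s≤s (s≤s z≤n)))
last-gray zero    = refl
last-gray (suc K) =
  trans (last-sjt (mapᴸ (map inject₁) (gray (2 + K))) even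
          (trans (last-map _ (gray (2 + K))) (cong (mapᴹ (map inject₁)) (last-gray K))))
        (cong just (perm213-∷ʳ K))
  where
  even : 2 ∣ length (mapᴸ (map inject₁) (gray (2 + K)))
  even = subst (2 ∣_) (sym (trans (length-map _ (gray (2 + K))) (length-gray (2 + K))))
           (m≤n⇒m!∣n! {2} {2 + K} (s≤s (s≤s z≤n)))

gray-isGrayCode : ∀ N → IsGrayCode N (gray N)
gray-isGrayCode N = gray-perm N , gray-complete N , gray-unique N , Linked.map Swap⇒lookup-τ (gray-linked N)

proposition4p12 : (n : ℕ) → (0<n : 0 < n) → 2 ∣ n →
    ∃ λ (L : List (Vec (Fin (suc n)) (suc n))) →
      IsGrayCode (suc n) L ×
      head L ≡ just (idPerm (suc n)) ×
      last L ≡ just (perm213 (suc n) (s≤s 0<n))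
proposition4p12 (suc K) (s≤s z≤n) _ =
  gray (2 + K) , gray-isGrayCode (2 + K) , head-gray (2 + K) , last-gray K
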